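{- Let $D$ be a finite source-free digraph. Then for every independent set $Q\subseteq V(D)$, there exists a $3$-kernel $Q'$ of $D$ which is disjoint from $Q$.
   Context: A digraph is source-free if every vertex has in-degree at least $1$. A set is independent if there are no arcs between two of its vertices. $\mathrm{dist}(S,v)$ is the minimum over $u\in S$ of the length of a shortest directed path from $u$ to $v$. A $q$-kernel is an independent set $Q$ with $\mathrm{dist}(Q,v)\le q$ for all $v\in V(D)$. -}

module Defs where

open import Data.Nat using (ℕ; zero; suc; _≤_)
open import Data.Fin using (Fin)
open import Data.Fin.Subset using (Subset; _∈_; _∉_)
open import Data.Bool using (Bool; true; false)
open import Data.Product using (Σ; ∃; _×_; _,_)
open import Relation.Binary.PropositionalEquality using (_≡_)
open import Relation.Nullary using (¬_)

record Digraph : Set where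
  field
    n        : ℕ
    arc      : Fin n → Fin n → Bool
    loopless : ∀ v → arc v v ≡ false

open Digraph public

Arc : (D : Digraph) → Fin (n D) → Fin (n D) → Set
Arc D u v = arc D u v ≡ true

SourceFree : Digraph → Set
SourceFree D = ∀ v → ∃ λ u → Arc D u v

Independent : (D : Digraph) → Subset (n D) → Set
Independent D S = ∀ u v → u ∈ S → v ∈ S → ¬ Arc D u v

data Walk (D : Digraph) : Fin (n D) → Fin (n D) → ℕ → Set where
  here : ∀ {u} → Walk D u u zero
  step : ∀ {u w v k} → Arc D u w → Walk D w v k → Walk D u v (suc k)

-- dist(S, v) ≤ q : some u ∈ S has a directed path (equivalently, walk) to v of length ≤ q
DistLe : (D : Digraph) → Subset (n D) → Fin (n D) → ℕ → Set
DistLe D S v q = Σ (Fin (n D)) λ u → Σ ℕ λ k → u ∈ S × k ≤ q × Walk D u v k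

IsKernel : ℕ → (D : Digraph) → Subset (n D) → Set
IsKernel q D Q = Independent D Q × (∀ v → DistLe D Q v q)

Disjoint : ∀ {m} → Subset m → Subset m → Set
Disjoint {m} S T = ∀ (v : Fin m) → v ∈ S → v ∉ T

module Submission where

open import Defs
open import Data.Product using (Σ; _×_)
open import Data.Fin.Subset using (Subset)

open import Data.Bool using (true)
import Data.Bool.Properties as Bool
open import Data.Nat using (suc; _≤_; z≤n; s≤s)
open import Data.Nat.Properties using (≤-refl; ≤-trans; n≤1+n)
open import Data.Fin using (Fin)
open import Data.Fin.Properties using (any?)
open import Data.Fin.Subset using (_∈_; _∉_; _⊆_; ⁅_⁆; _∪_; ∁; ⊥)
open import Data.Fin.Subset.Properties
  using (_∈?_; ∉⊥; x∈⁅x⁆; x∈⁅y⁆⇒x≡y; x∈p∪q⁻; ⊆-refl; p⊆p∪q; q⊆p∪q; x∉p⇒x∈∁p; x∈∁p⇒x∉p)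
open import Data.List using (List; []; _∷_; length; filter; allFin)
open import Data.List.Properties using (length-filter)
open import Data.List.Membership.Propositional using () renaming (_∈_ to _∈ₗ_)
open import Data.List.Membership.Propositional.Properties using (∈-filter⁺; ∈-filter⁻; ∈-allFin)
open import Data.List.Relation.Unary.Any using (here; there)
open import Data.Product using (∃; _,_; proj₁; proj₂)
open import Data.Sum using (inj₁; inj₂)
open import Data.Empty using (⊥-elim)
open import Relation.Nullary using (¬_; Dec; yes; no)
open import Relation.Nullary.Decidable using (¬?; _×-dec_)
open import Relation.Binary.PropositionalEquality using (refl; sym; trans)

-- Outside Q, an independent set K reaching every vertex within two steps is built greedily:
-- take a vertex x, recurse on the remaining vertices that are not out-neighbours of x, and add
-- x to the result unless some member already has an arc into x; in both cases x and its
-- out-neighbours are reached within two steps. Every vertex of the independent set Q has an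
-- in-neighbour, which lies outside Q, so Q itself is reached within three steps.

module _ (D : Digraph) where

  private
    V : Set
    V = Fin (n D)

  Arc? : (u v : V) → Dec (Arc D u v)
  Arc? u v = arc D u v Bool.≟ true

  ¬Arc-refl : ∀ v → ¬ Arc D v v
  ¬Arc-refl v v→v with trans (sym v→v) (loopless D v)
  ... | ()

  Walk-snoc : ∀ {u w v k} → Walk D u w k → Arc D w v → Walk D u v (suc k)
  Walk-snoc here       w→v = step w→v here
  Walk-snoc (step a p) w→v = step a (Walk-snoc p w→v)

  DistLe-refl : ∀ {S v} → v ∈ S → DistLe D S v 0
  DistLe-refl {v = v} v∈S = v , 0 , v∈S , z≤n , here

  DistLe-weaken : ∀ {S v p q} → p ≤ q → DistLe D S v p → DistLe D S v q
  DistLe-weaken p≤q (u , k , u∈S , k≤p , walk) = u , k , u∈S , ≤-trans k≤p p≤q , walk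

  DistLe-mono : ∀ {S T v q} → S ⊆ T → DistLe D S v q → DistLe D T v q
  DistLe-mono S⊆T (u , k , u∈S , k≤q , walk) = u , k , S⊆T u∈S , k≤q , walk

  DistLe-step : ∀ {S u v q} → DistLe D S u q → Arc D u v → DistLe D S v (suc q)
  DistLe-step (w , k , w∈S , k≤q , walk) u→v = w , suc k , w∈S , s≤s k≤q , Walk-snoc walk u→v

  -- Only the vertices of xs must be reached, but the walks may leave xs.
  record QuasiKernelFor (xs : List V) : Set where
    field
      K           : Subset (n D)
      K⊆xs        : ∀ {u} → u ∈ K → u ∈ₗ xs
      independent : Independent D K
      reaches     : ∀ {v} → v ∈ₗ xs → DistLe D K v 2

  open QuasiKernelFor

  nonSuccessor? : ∀ x w → Dec (¬ Arc D x w)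
  nonSuccessor? x w = ¬? (Arc? x w)

  nonSuccessors : V → List V → List V
  nonSuccessors x = filter (nonSuccessor? x)

  module _ (x : V) (xs : List V) (Q : QuasiKernelFor (nonSuccessors x xs)) where

    K⊆x∷xs : ∀ {u} → u ∈ K Q → u ∈ₗ x ∷ xs
    K⊆x∷xs u∈K = there (proj₁ (∈-filter⁻ (nonSuccessor? x) (K⊆xs Q u∈K)))

    K-nonSuccessor : ∀ {u} → u ∈ K Q → ¬ Arc D x u
    K-nonSuccessor u∈K = proj₂ (∈-filter⁻ (nonSuccessor? x) {xs = xs} (K⊆xs Q u∈K))

    reaches-cons : ∀ {K′} → K Q ⊆ K′ → DistLe D K′ x 1 → ∀ {v} → v ∈ₗ x ∷ xs → DistLe D K′ v 2
    reaches-cons K⊆K′ x-near (here refl) = DistLe-weaken (n≤1+n 1) x-near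
    reaches-cons K⊆K′ x-near {v} (there v∈xs) with Arc? x v
    ... | yes x→v = DistLe-step x-near x→v
    ... | no ¬x→v = DistLe-mono K⊆K′ (reaches Q (∈-filter⁺ (nonSuccessor? x) v∈xs ¬x→v))

    extend-absorbed : ∀ {u} → u ∈ K Q → Arc D u x → QuasiKernelFor (x ∷ xs)
    extend-absorbed u∈K u→x = record
      { K           = K Q
      ; K⊆xs        = K⊆x∷xs
      ; independent = independent Q
      ; reaches     = reaches-cons ⊆-refl (DistLe-step (DistLe-refl u∈K) u→x)
      }

    independent-add : (∀ u → u ∈ K Q → ¬ Arc D u x) → Independent D (⁅ x ⁆ ∪ K Q)
    independent-add unabsorbed u v u∈ v∈ u→v with x∈p∪q⁻ ⁅ x ⁆ (K Q) u∈ | x∈p∪q⁻ ⁅ x ⁆ (K Q) v∈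
    ... | inj₁ u∈x | inj₁ v∈x
      rewrite x∈⁅y⁆⇒x≡y x u∈x | x∈⁅y⁆⇒x≡y x v∈x = ¬Arc-refl x u→v
    ... | inj₁ u∈x | inj₂ v∈K rewrite x∈⁅y⁆⇒x≡y x u∈x = K-nonSuccessor v∈K u→v
    ... | inj₂ u∈K | inj₁ v∈x rewrite x∈⁅y⁆⇒x≡y x v∈x = unabsorbed u u∈K u→v
    ... | inj₂ u∈K | inj₂ v∈K = independent Q u v u∈K v∈K u→v

    extend-added : (∀ u → u ∈ K Q → ¬ Arc D u x) → QuasiKernelFor (x ∷ xs)
    extend-added unabsorbed = record
      { K           = ⁅ x ⁆ ∪ K Q
      ; K⊆xs        = K⊆
      ; independent = independent-add unabsorbed
      ; reaches     = reaches-cons (q⊆p∪q ⁅ x ⁆ (K Q))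
                                   (DistLe-weaken z≤n (DistLe-refl (p⊆p∪q (K Q) (x∈⁅x⁆ x))))
      }
      where
        K⊆ : ∀ {u} → u ∈ ⁅ x ⁆ ∪ K Q → u ∈ₗ x ∷ xs
        K⊆ u∈ with x∈p∪q⁻ ⁅ x ⁆ (K Q) u∈
        ... | inj₁ u∈x = here (x∈⁅y⁆⇒x≡y x u∈x)
        ... | inj₂ u∈K = K⊆x∷xs u∈K

    absorbed? : Dec (∃ λ u → u ∈ K Q × Arc D u x)
    absorbed? = any? (λ u → (u ∈? K Q) ×-dec Arc? u x)

    extend : Dec (∃ λ u → u ∈ K Q × Arc D u x) → QuasiKernelFor (x ∷ xs)
    extend (yes (u , u∈K , u→x)) = extend-absorbed u∈K u→x
    extend (no unabsorbed)       = extend-added (λ u u∈K u→x → unabsorbed (u , u∈K , u→x))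

  quasiKernelFor-bounded : ∀ m xs → length xs ≤ m → QuasiKernelFor xs
  quasiKernelFor-bounded _ [] _ = record
    { K           = ⊥
    ; K⊆xs        = λ u∈⊥ → ⊥-elim (∉⊥ u∈⊥)
    ; independent = λ _ _ u∈⊥ → ⊥-elim (∉⊥ u∈⊥)
    ; reaches     = λ ()
    }
  quasiKernelFor-bounded (suc m) (x ∷ xs) (s≤s |xs|≤m) = extend x xs Q (absorbed? x xs Q)
    where
      Q : QuasiKernelFor (nonSuccessors x xs)
      Q = quasiKernelFor-bounded m (nonSuccessors x xs)
            (≤-trans (length-filter (nonSuccessor? x) xs) |xs|≤m)

  quasiKernelFor : ∀ xs → QuasiKernelFor xs
  quasiKernelFor xs = quasiKernelFor-bounded (length xs) xs ≤-refl

  quasiKernelWithin : (S : Subset (n D)) →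
    Σ (Subset (n D)) λ K → K ⊆ S × Independent D K × (∀ {v} → v ∈ S → DistLe D K v 2)
  quasiKernelWithin S =
    K Q , (λ u∈K → proj₂ (∈-filter⁻ (_∈? S) {xs = allFin (n D)} (K⊆xs Q u∈K))) , independent Q ,
    (λ v∈S → reaches Q (∈-filter⁺ (_∈? S) (∈-allFin _) v∈S))
    where
      Q : QuasiKernelFor (filter (_∈? S) (allFin (n D)))
      Q = quasiKernelFor (filter (_∈? S) (allFin (n D)))

  DistLe-sourceFree-suc : SourceFree D → ∀ {Q K q} → Independent D Q →
    (∀ {v} → v ∉ Q → DistLe D K v q) → ∀ v → DistLe D K v (suc q)
  DistLe-sourceFree-suc sourceFree {Q} {q = q} independentQ nearOutside v with v ∈? Q
  ... | no v∉Q = DistLe-weaken (n≤1+n q) (nearOutside v∉Q)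
  ... | yes v∈Q with sourceFree v
  ... | u , u→v = DistLe-step (nearOutside (λ u∈Q → independentQ u v u∈Q v∈Q u→v)) u→v

lemma5p4 : (D : Digraph) → SourceFree D → (Q : Subset (n D)) → Independent D Q →
    Σ (Subset (n D)) (λ Q′ → IsKernel 3 D Q′ × Disjoint Q Q′)
lemma5p4 D sourceFree Q independentQ with quasiKernelWithin D (∁ Q)
... | K , K⊆∁Q , independentK , nearOutside =
  K , (independentK , reaches₃) , λ v v∈Q v∈K → x∈∁p⇒x∉p (K⊆∁Q v∈K) v∈Q
  where
    reaches₃ : ∀ v → DistLe D K v 3
    reaches₃ = DistLe-sourceFree-suc D sourceFree independentQ (λ v∉Q → nearOutside (x∉p⇒x∈∁p v∉Q))
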